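{- Every Parikh word representable graph is a bipartite permutation graph.
   Context: Let $\Sigma=\{a_1<a_2<\dots<a_s\}$ be a finite ordered alphabet and $w=w_1w_2\cdots w_n$ a nonempty word over $\Sigma$ with each $w_i\in\Sigma$. The Parikh graph $\mathcal{G}(w)$ of $w$ over $\Sigma$ is the simple undirected graph with vertex set $\{1,\dots,n\}$ in which, for $1\le i<j\le n$, the vertices $i$ and $j$ are adjacent if and only if $w_i=a_k$ and $w_j=a_{k+1}$ for some $1\le k\le s-1$. A graph $G$ is Parikh word representable if $G$ is isomorphic to $\mathcal{G}(w)$ for some nonempty word $w$ over some finite ordered alphabet. A graph $G=(V,E)$ is a permutation graph if there is an ordering $v_1,\dots,v_n$ of $V$ and a permutation $\tau$ of $\{1,\dots,n\}$ such that for all $1\le i<j\le n$, $(v_i,v_j)\in E$ if and only if $\tau(i)>\tau(j)$. A bipartite permutation graph is a graph that is both bipartite and a permutation graph. -}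

module Defs where

open import Data.Nat using (ℕ; suc; _<_; _>_)
open import Data.Fin using (Fin; toℕ)
open import Data.Bool using (Bool)
open import Data.Product using (Σ; ∃; _×_; _,_)
open import Data.Empty using (⊥)
open import Data.Sum using (_⊎_; inj₁; inj₂)
open import Data.Nat.Properties using (<-irrefl)
open import Relation.Nullary using (¬_)
open import Relation.Binary.PropositionalEquality using (_≡_; _≢_; refl)
open import Function.Bundles using (_↔_; _⇔_; Inverse)

record Graph : Set₁ where
  field
    size  : ℕ
    Adj   : Fin size → Fin size → Set
    sym   : ∀ {u v} → Adj u v → Adj v u
    irrefl : ∀ {u} → ¬ Adj u u
open Graph public

_≅_ : Graph → Graph → Set
G ≅ H = Σ (Fin (size G) ↔ Fin (size H)) λ f →
          ∀ u v → (Adj G u v ⇔ Adj H (Inverse.to f u) (Inverse.to f v))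

_<ᶠ_ : ∀ {n} → Fin n → Fin n → Set
i <ᶠ j = toℕ i < toℕ j

-- A word of length n over the ordered alphabet a_1 < ... < a_s, encoded as
-- Fin s (a_{k+1} is the letter with toℕ = k; order of Fin is the alphabet order).
Word : ℕ → ℕ → Set
Word s n = Fin n → Fin s

ParikhEdge : ∀ {s n} → Word s n → Fin n → Fin n → Set
ParikhEdge w i j = i <ᶠ j × toℕ (w j) ≡ suc (toℕ (w i))

ParikhAdj : ∀ {s n} → Word s n → Fin n → Fin n → Set
ParikhAdj w i j = ParikhEdge w i j ⊎ ParikhEdge w j i

parikh-sym : ∀ {s n} (w : Word s n) {u v : Fin n} → ParikhAdj w u v → ParikhAdj w v u
parikh-sym w (inj₁ e) = inj₂ e
parikh-sym w (inj₂ e) = inj₁ e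

parikh-irrefl : ∀ {s n} (w : Word s n) {u : Fin n} → ¬ ParikhAdj w u u
parikh-irrefl w (inj₁ (lt , _)) = <-irrefl refl lt
parikh-irrefl w (inj₂ (lt , _)) = <-irrefl refl lt

ParikhGraph : ∀ {s n} → Word s n → Graph
ParikhGraph {s} {n} w = record
  { size = n ; Adj = ParikhAdj w ; sym = parikh-sym w ; irrefl = parikh-irrefl w }

ParikhRepresentable : Graph → Set
ParikhRepresentable G =
  Σ ℕ λ s → Σ ℕ λ n → Σ (Word s n) λ w → (0 < n) × (G ≅ ParikhGraph w)

Bipartite : Graph → Set
Bipartite G = Σ (Fin (size G) → Bool) λ c → ∀ u v → Adj G u v → c u ≢ c v

PermutationGraph : Graph → Set
PermutationGraph G =
  Σ (Fin (size G) ↔ Fin (size G)) λ ord →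
  Σ (Fin (size G) ↔ Fin (size G)) λ τ →
  ∀ i j → i <ᶠ j →
    (Adj G (Inverse.to ord i) (Inverse.to ord j) ⇔ Inverse.to τ j <ᶠ Inverse.to τ i)

BipartitePermutationGraph : Graph → Set
BipartitePermutationGraph G = Bipartite G × PermutationGraph G

module Submission where

-- Both properties are invariant under isomorphism, so it suffices to treat
-- the Parikh graph G(w) of a word w itself.  Bipartiteness is immediate:
-- adjacent vertices carry consecutive letters, so colouring a vertex by the
-- parity of its letter is proper.
--
-- For the permutation property we use the classical criterion: G is a
-- permutation graph as soon as its vertices carry two linear orders such
-- that two vertices are adjacent exactly when the orders disagree on them
-- (a "realizer").  Ranking the vertices along each order turns such a
-- realizer into the ordering and the permutation demanded by the
-- definition.  For G(w) the two orders are lexicographic: a vertex with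
-- letter a at position p gets the key (⌊a/2⌋ , p), respectively
-- (⌈a/2⌉ , p), ordered by decreasing first and increasing second
-- component.  The pairing of letters {2k, 2k+1} (first order) versus
-- {2k-1, 2k} (second order) makes the two orders disagree precisely on
-- pairs "letter c, then letter c+1 later in the word".

open import Defs
open import Level using (0ℓ)
open import Data.Nat using (ℕ; suc; _+_; _<_; _≤_; s≤s; s≤s⁻¹; ⌊_/2⌋; ⌈_/2⌉)
open import Data.Nat.Properties
  using (1+n≰n; <-irrefl; <⇒≢; <-asym; <⇒≤; ≤-reflexive; ≤-trans; <-≤-trans; <-transʳ; ≤-antisym;
         +-suc; ⌊n/2⌋≤⌈n/2⌉; ⌊n/2⌋+⌈n/2⌉≡n; <-strictTotalOrder)
open import Data.Fin using (Fin; toℕ; fromℕ<; punchOut)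
open import Data.Fin.Properties using (toℕ-injective; toℕ-fromℕ<; punchOut-injective; any?; injective⇒≤)
  renaming (_≟_ to _≟ᶠ_)
open import Data.Fin.Subset using (Subset; _∈_; ⊤; ∣_∣)
open import Data.Fin.Subset.Properties using (p⊂q⇒∣p∣<∣q∣; ∣⊤∣≡n; ∈⊤)
open import Data.Vec using (tabulate)
open import Data.Vec.Properties using (lookup∘tabulate; []=⇒lookup; lookup⇒[]=)
open import Data.Bool using (Bool; true; false; not)
open import Data.Bool.Properties using (not-¬)
open import Data.Product using (Σ; ∃; _×_; _,_; proj₁; proj₂)
open import Data.Product.Relation.Binary.Lex.Strict using (×-strictTotalOrder)
open import Data.Sum using (_⊎_; inj₁; inj₂)
open import Relation.Nullary using (¬_; Dec; does; yes; no; contradiction)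
open import Relation.Nullary.Decidable using (dec-true)
open import Relation.Binary.Bundles using (StrictTotalOrder)
open import Relation.Binary.Definitions using (tri<; tri≈; tri>)
import Relation.Binary.Construct.Flip.EqAndOrd as Flip
open import Relation.Binary.PropositionalEquality
  using (_≡_; _≢_; refl; trans; cong; subst; subst₂; module ≡-Reasoning)
  renaming (sym to ≡-sym)
open import Function.Base using (_∘_)
open import Function.Bundles using (_↔_; _⇔_; Inverse; Equivalence; Injection; mk↔ₛ′; mk⇔)
open import Function.Definitions using (Injective)
open import Function.Properties.Inverse using (↔⇒↣)
open import Function.Construct.Symmetry using (↔-sym)
open import Function.Construct.Composition using (_↔-∘_; _⇔-∘_)

-- An injective endomap of Fin m is surjective: if it missed a value y,
-- punching y out would inject Fin m into a set with one element fewer.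
injective⇒surjective : ∀ {m} (f : Fin m → Fin m) → Injective _≡_ _≡_ f →
                       ∀ y → ∃ λ x → f x ≡ y
injective⇒surjective {suc m} f f-inj y with any? (λ x → f x ≟ᶠ y)
... | yes hit = hit
... | no miss = contradiction (injective⇒≤ squeezed-injective) 1+n≰n
  where
  misses : ∀ x → y ≢ f x
  misses x e = miss (x , ≡-sym e)

  squeezed : Fin (suc m) → Fin m
  squeezed x = punchOut (misses x)

  squeezed-injective : Injective _≡_ _≡_ squeezed
  squeezed-injective {x} {x′} e = f-inj (punchOut-injective (misses x) (misses x′) e)

injective⇒↔ : ∀ {m} (f : Fin m → Fin m) → Injective _≡_ _≡_ f → Fin m ↔ Fin m
injective⇒↔ f f-inj = mk↔ₛ′ f (proj₁ ∘ surj) (proj₂ ∘ surj) (λ x → f-inj (proj₂ (surj (f x))))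
  where
  surj : ∀ y → ∃ λ x → f x ≡ y
  surj = injective⇒surjective f f-inj

dec-true⁻¹ : ∀ {A : Set} (a? : Dec A) → does a? ≡ true → A
dec-true⁻¹ (yes a) _ = a

record LinearOrder (m : ℕ) : Set₁ where
  field
    keys          : StrictTotalOrder 0ℓ 0ℓ 0ℓ
    key           : Fin m → StrictTotalOrder.Carrier keys
    key-injective : ∀ {u v} → StrictTotalOrder._≈_ keys (key u) (key v) → u ≡ v

  infix 4 _≺_
  _≺_ : Fin m → Fin m → Set
  u ≺ v = StrictTotalOrder._<_ keys (key u) (key v)

pullback : ∀ {m n} → LinearOrder n → (f : Fin m → Fin n) → Injective _≡_ _≡_ f →
           LinearOrder m
pullback L f f-inj = record
  { keys = keys ; key = key ∘ f ; key-injective = f-inj ∘ key-injective }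
  where open LinearOrder L

Ranking : ∀ {m} → LinearOrder m → Set
Ranking {m} L = Σ (Fin m ↔ Fin m) λ ρ → ∀ u v → u ≺ v ⇔ Inverse.to ρ u <ᶠ Inverse.to ρ v
  where open LinearOrder L

-- Every linear order has a ranking: the rank of v is the number of
-- vertices below v.
module _ {m : ℕ} (L : LinearOrder m) where
  open LinearOrder L
  open StrictTotalOrder keys using (_<?_; compare; module Eq)
    renaming (trans to ≺-trans; irrefl to ≺-irrefl)

  below : Fin m → Subset m
  below v = tabulate (λ u → does (key u <? key v))

  ∈-below : ∀ {u v} → u ∈ below v ⇔ u ≺ v
  ∈-below {u} {v} = mk⇔
    (λ u∈ → dec-true⁻¹ (key u <? key v) (trans (≡-sym (lookup∘tabulate _ u)) ([]=⇒lookup u∈)))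
    (λ u≺v → lookup⇒[]= u (below v)
               (trans (lookup∘tabulate _ u) (dec-true (key u <? key v) u≺v)))

  v∉below-v : ∀ {v} → ¬ v ∈ below v
  v∉below-v v∈ = ≺-irrefl Eq.refl (Equivalence.to ∈-below v∈)

  rank : Fin m → ℕ
  rank v = ∣ below v ∣

  rank-< : ∀ {u v} → u ≺ v → rank u < rank v
  rank-< u≺v = p⊂q⇒∣p∣<∣q∣
    ( (λ t∈ → Equivalence.from ∈-below (≺-trans (Equivalence.to ∈-below t∈) u≺v))
    , _ , Equivalence.from ∈-below u≺v , v∉below-v )

  rank<m : ∀ v → rank v < m
  rank<m v = subst (rank v <_) (∣⊤∣≡n m) (p⊂q⇒∣p∣<∣q∣ ((λ _ → ∈⊤) , v , ∈⊤ , v∉below-v))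

  position : Fin m → Fin m
  position v = fromℕ< (rank<m v)

  position-< : ∀ {u v} → u ≺ v → position u <ᶠ position v
  position-< {u} {v} u≺v =
    subst₂ _<_ (≡-sym (toℕ-fromℕ< (rank<m u))) (≡-sym (toℕ-fromℕ< (rank<m v))) (rank-< u≺v)

  position-reflects : ∀ {u v} → position u <ᶠ position v → u ≺ v
  position-reflects {u} {v} lt with compare (key u) (key v)
  ... | tri< u≺v _ _ = u≺v
  ... | tri≈ _ u≈v _ = contradiction (cong (toℕ ∘ position) (key-injective u≈v)) (<⇒≢ lt)
  ... | tri> _ _ v≺u = contradiction lt (<-asym (position-< v≺u))

  position-injective : Injective _≡_ _≡_ position
  position-injective {u} {v} e with compare (key u) (key v)
  ... | tri< u≺v _ _ = contradiction (cong toℕ e) (<⇒≢ (position-< u≺v))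
  ... | tri≈ _ u≈v _ = key-injective u≈v
  ... | tri> _ _ v≺u = contradiction (cong toℕ (≡-sym e)) (<⇒≢ (position-< v≺u))

  ranking : Ranking L
  ranking = injective⇒↔ position position-injective
          , λ u v → mk⇔ position-< position-reflects

record Realizer (G : Graph) : Set₁ where
  field
    first second : LinearOrder (size G)

  open LinearOrder first  public using () renaming (_≺_ to _≺₁_)
  open LinearOrder second public using () renaming (_≺_ to _≺₂_)

  field
    adjacent⇔reversed : ∀ u v → u ≺₁ v → (Adj G u v ⇔ v ≺₂ u)

-- A graph with a realizer is a permutation graph: list the vertices in
-- the first order and let τ send the i-th of them to its rank in the
-- second order.
realizer⇒permutation : ∀ {G} → Realizer G → PermutationGraph G
realizer⇒permutation {G} R = ord , τ , edges
  where
  open Realizer R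

  ρ₁ : Ranking first
  ρ₁ = ranking first

  ρ₂ : Ranking second
  ρ₂ = ranking second

  ord τ : Fin (size G) ↔ Fin (size G)
  ord = ↔-sym (proj₁ ρ₁)
  τ   = proj₁ ρ₂ ↔-∘ ord

  edges : ∀ i j → i <ᶠ j →
          (Adj G (Inverse.to ord i) (Inverse.to ord j) ⇔ Inverse.to τ j <ᶠ Inverse.to τ i)
  edges i j i<j = proj₂ ρ₂ v u ⇔-∘ adjacent⇔reversed u v u≺₁v
    where
    u v : Fin (size G)
    u = Inverse.to ord i
    v = Inverse.to ord j

    u≺₁v : u ≺₁ v
    u≺₁v = Equivalence.from (proj₂ ρ₁ u v)
             (subst₂ _<ᶠ_ (≡-sym (Inverse.strictlyInverseˡ (proj₁ ρ₁) i))
                          (≡-sym (Inverse.strictlyInverseˡ (proj₁ ρ₁) j)) i<j)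

realizer-transport : ∀ {G H} → G ≅ H → Realizer H → Realizer G
realizer-transport (f , iso) R = record
  { first  = pullback first (Inverse.to f) f-injective
  ; second = pullback second (Inverse.to f) f-injective
  ; adjacent⇔reversed = λ u v u≺v →
      adjacent⇔reversed (Inverse.to f u) (Inverse.to f v) u≺v ⇔-∘ iso u v
  }
  where
  open Realizer R
  f-injective : Injective _≡_ _≡_ (Inverse.to f)
  f-injective = Injection.injective (↔⇒↣ f)

bipartite-transport : ∀ {G H} → G ≅ H → Bipartite H → Bipartite G
bipartite-transport (f , iso) (colour , proper) =
  colour ∘ Inverse.to f , λ u v uv → proper _ _ (Equivalence.to (iso u v) uv)

Consecutive : ℕ → ℕ → ℕ → ℕ → Set
Consecutive a b p q = (p < q × b ≡ suc a) ⊎ (q < p × a ≡ suc b)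

odd : ℕ → Bool
odd 0       = false
odd (suc n) = not (odd n)

consecutive⇒parity≢ : ∀ {a b p q} → Consecutive a b p q → odd a ≢ odd b
consecutive⇒parity≢ (inj₁ (_ , refl)) = not-¬ refl
consecutive⇒parity≢ (inj₂ (_ , refl)) = not-¬ refl ∘ ≡-sym

parikh-bipartite : ∀ {s n} (w : Word s n) → Bipartite (ParikhGraph w)
parikh-bipartite w = odd ∘ toℕ ∘ w , λ _ _ → consecutive⇒parity≢

descending-then-ascending : StrictTotalOrder 0ℓ 0ℓ 0ℓ
descending-then-ascending =
  ×-strictTotalOrder (Flip.strictTotalOrder <-strictTotalOrder) <-strictTotalOrder

infix 4 _⊏_
_⊏_ : ℕ × ℕ → ℕ × ℕ → Set
_⊏_ = StrictTotalOrder._<_ descending-then-ascending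

⊏-head : ∀ {x y p q} → (x , p) ⊏ (y , q) → y ≤ x
⊏-head (inj₁ y<x)       = <⇒≤ y<x
⊏-head (inj₂ (x≡y , _)) = ≤-reflexive (≡-sym x≡y)

⊏-tail : ∀ {x y p q} → (x , p) ⊏ (y , q) → x ≡ y → p < q
⊏-tail (inj₁ y<x)     x≡y = contradiction y<x (<-irrefl (≡-sym x≡y))
⊏-tail (inj₂ (_ , p<q)) _ = p<q

⊏-head-strict : ∀ {x y p q} → (x , p) ⊏ (y , q) → q < p → y < x
⊏-head-strict (inj₁ y<x)       _   = y<x
⊏-head-strict (inj₂ (_ , p<q)) q<p = contradiction p<q (<-asym q<p)

⌈n/2⌉≤1+⌊n/2⌋ : ∀ n → ⌈ n /2⌉ ≤ suc ⌊ n /2⌋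
⌈n/2⌉≤1+⌊n/2⌋ n = ⌊n/2⌋≤⌈n/2⌉ (suc n)

from-halves : ∀ n {h c} → ⌊ n /2⌋ ≡ h → ⌈ n /2⌉ ≡ c → n ≡ h + c
from-halves n refl refl = ≡-sym (⌊n/2⌋+⌈n/2⌉≡n n)

-- An edge is reversed by the second order: b = a+1 forces ⌈a/2⌉ ≤ ⌊a/2⌋
-- (so a is even and ⌈b/2⌉ = ⌈a/2⌉ + 1), while a = b+1 forces ⌊b/2⌋ < ⌈b/2⌉
-- (so b is odd and ⌈a/2⌉ = ⌈b/2⌉, with the later position first).
consecutive⇒reversed : ∀ a b p q → (⌊ a /2⌋ , p) ⊏ (⌊ b /2⌋ , q) →
                       Consecutive a b p q → (⌈ b /2⌉ , q) ⊏ (⌈ a /2⌉ , p)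
consecutive⇒reversed a _ p q first (inj₁ (_ , refl)) = inj₁ (s≤s (⊏-head first))
consecutive⇒reversed _ b p q (inj₁ h<c) (inj₂ (q<p , refl)) =
  inj₂ (≤-antisym (⌈n/2⌉≤1+⌊n/2⌋ b) h<c , q<p)
consecutive⇒reversed _ b p q (inj₂ (_ , p<q)) (inj₂ (q<p , _)) = contradiction p<q (<-asym q<p)

separated-ceilings : ∀ a b {p q} → (⌊ a /2⌋ , p) ⊏ (⌊ b /2⌋ , q) →
                     ⌈ a /2⌉ < ⌈ b /2⌉ → p < q × b ≡ suc a
separated-ceilings a b {p} {q} first ca<cb = p<q , b≡1+a
  where
  -- ⌊b/2⌋ ≤ ⌊a/2⌋ ≤ ⌈a/2⌉ < ⌈b/2⌉ ≤ ⌊b/2⌋ + 1 squeezes all four values.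
  hb≤ha : ⌊ b /2⌋ ≤ ⌊ a /2⌋
  hb≤ha = ⊏-head first

  ca≤hb : ⌈ a /2⌉ ≤ ⌊ b /2⌋
  ca≤hb = s≤s⁻¹ (<-≤-trans ca<cb (⌈n/2⌉≤1+⌊n/2⌋ b))

  ha≡hb : ⌊ a /2⌋ ≡ ⌊ b /2⌋
  ha≡hb = ≤-antisym (≤-trans (⌊n/2⌋≤⌈n/2⌉ a) ca≤hb) hb≤ha

  ca≡hb : ⌈ a /2⌉ ≡ ⌊ b /2⌋
  ca≡hb = ≤-antisym ca≤hb (≤-trans hb≤ha (⌊n/2⌋≤⌈n/2⌉ a))

  cb≡1+hb : ⌈ b /2⌉ ≡ suc ⌊ b /2⌋
  cb≡1+hb = ≤-antisym (⌈n/2⌉≤1+⌊n/2⌋ b) (subst (λ t → suc t ≤ ⌈ b /2⌉) ca≡hb ca<cb)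

  p<q : p < q
  p<q = ⊏-tail first ha≡hb

  b≡1+a : b ≡ suc a
  b≡1+a = let open ≡-Reasoning in begin
    b                         ≡⟨ from-halves b refl cb≡1+hb ⟩
    ⌊ b /2⌋ + suc ⌊ b /2⌋     ≡⟨ +-suc ⌊ b /2⌋ ⌊ b /2⌋ ⟩
    suc (⌊ b /2⌋ + ⌊ b /2⌋)   ≡⟨ cong suc (≡-sym (from-halves a ha≡hb ca≡hb)) ⟩
    suc a                     ∎

equal-ceilings : ∀ a b {p q} → (⌊ a /2⌋ , p) ⊏ (⌊ b /2⌋ , q) →
                 ⌈ b /2⌉ ≡ ⌈ a /2⌉ → q < p → a ≡ suc b
equal-ceilings a b first cb≡ca q<p = begin
  a                             ≡⟨ from-halves a ha≡1+hb ca≡1+hb ⟩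
  suc ⌊ b /2⌋ + suc ⌊ b /2⌋     ≡⟨ cong suc (≡-sym (from-halves b refl cb≡1+hb)) ⟩
  suc b                         ∎
  where
  open ≡-Reasoning
  -- ⌊b/2⌋ < ⌊a/2⌋ ≤ ⌈a/2⌉ = ⌈b/2⌉ ≤ ⌊b/2⌋ + 1 squeezes all values to ⌊b/2⌋ + 1.
  hb<ha : ⌊ b /2⌋ < ⌊ a /2⌋
  hb<ha = ⊏-head-strict first q<p

  ca≤1+hb : ⌈ a /2⌉ ≤ suc ⌊ b /2⌋
  ca≤1+hb = ≤-trans (≤-reflexive (≡-sym cb≡ca)) (⌈n/2⌉≤1+⌊n/2⌋ b)

  ha≡1+hb : ⌊ a /2⌋ ≡ suc ⌊ b /2⌋
  ha≡1+hb = ≤-antisym (≤-trans (⌊n/2⌋≤⌈n/2⌉ a) ca≤1+hb) hb<ha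

  ca≡1+hb : ⌈ a /2⌉ ≡ suc ⌊ b /2⌋
  ca≡1+hb = ≤-antisym ca≤1+hb (≤-trans hb<ha (⌊n/2⌋≤⌈n/2⌉ a))

  cb≡1+hb : ⌈ b /2⌉ ≡ suc ⌊ b /2⌋
  cb≡1+hb = trans cb≡ca ca≡1+hb

reversed⇒consecutive : ∀ a b p q → (⌊ a /2⌋ , p) ⊏ (⌊ b /2⌋ , q) →
                       (⌈ b /2⌉ , q) ⊏ (⌈ a /2⌉ , p) → Consecutive a b p q
reversed⇒consecutive a b p q first (inj₁ ca<cb)        = inj₁ (separated-ceilings a b first ca<cb)
reversed⇒consecutive a b p q first (inj₂ (cb≡ca , q<p)) = inj₂ (q<p , equal-ceilings a b first cb≡ca q<p)

by-halved-letter : ∀ {s n} → (ℕ → ℕ) → Word s n → LinearOrder n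
by-halved-letter half w = record
  { keys          = descending-then-ascending
  ; key           = λ i → half (toℕ (w i)) , toℕ i
  ; key-injective = toℕ-injective ∘ proj₂
  }

parikh-realizer : ∀ {s n} (w : Word s n) → Realizer (ParikhGraph w)
parikh-realizer w = record
  { first  = by-halved-letter ⌊_/2⌋ w
  ; second = by-halved-letter ⌈_/2⌉ w
  ; adjacent⇔reversed = λ u v u≺v →
      mk⇔ (consecutive⇒reversed _ _ _ _ u≺v) (reversed⇒consecutive _ _ _ _ u≺v)
  }

theorem4p4 : (G : Graph) → ParikhRepresentable G → BipartitePermutationGraph G
theorem4p4 G (_ , _ , w , _ , G≅Gw) =
    bipartite-transport {G} {ParikhGraph w} G≅Gw (parikh-bipartite w)
  , realizer⇒permutation {G} (realizer-transport {G} {ParikhGraph w} G≅Gw (parikh-realizer w))
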